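{- Let $\mathbb X_i=\langle X_i,\rho_i\rangle$, $i\in I$, be $L_b$-structures with pairwise disjoint domains such that each $\mathbb X_i$ is connected and reversible, and let $\mathbb X=\bigcup_{i\in I}\mathbb X_i$. Then $\mathbb X$ is reversible if and only if $\langle \mathbb X_i: i\in I\rangle$ is a reversible sequence of structures and every $\mathbb Z$-sequence in $I$ is trivial.
   Context: An $L_b$-structure is a pair $\langle X,\rho\rangle$ with $\rho\subseteq X^2$. A homomorphism $f:\langle X,\rho\rangle\to\langle Y,\sigma\rangle$ is a map with $\langle x,y\rangle\in\rho\Rightarrow\langle f(x),f(y)\rangle\in\sigma$; a condensation is a bijective homomorphism; an isomorphism is a bijection $f$ with $\langle x,y\rangle\in\rho\Leftrightarrow\langle f(x),f(y)\rangle\in\sigma$. A structure is reversible iff every condensation from it to itself is an automorphism. The components of $\langle X,\rho\rangle$ are the classes of the smallest equivalence relation on $X$ containing $\rho$; the structure is connected iff it has exactly one component. For structures $\langle X_i,\rho_i\rangle$ with pairwise disjoint domains, $\bigcup_{i\in J}\mathbb X_i=\langle\bigcup_{i\in J}X_i,\bigcup_{i\in J}\rho_i\rangle$. Write $\mathbb Y\preccurlyeq_c\mathbb Z$ iff there is a condensation $\mathbb Y\to\mathbb Z$. $\mathrm{Sur}(I)$ (resp. $\mathrm{Sym}(I)$) is the set of surjections (resp. bijections) $I\to I$. The sequence $\langle\mathbb X_i:i\in I\rangle$ is a reversible sequence of structures iff there is no $f\in\mathrm{Sur}(I)\setminus\mathrm{Sym}(I)$ such that $\bigcup_{i\in f^{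 -1}[\{j\}]}\mathbb X_i\preccurlyeq_c\mathbb X_j$ for all $j\in I$. A $\mathbb Z$-sequence in $I$ is an injection $k\mapsto i_k$ from $\mathbb Z$ to $I$ such that $\mathbb X_{i_k}\preccurlyeq_c\mathbb X_{i_l}$ whenever $k<l$; it is trivial iff $\mathbb X_{i_k}\cong\mathbb X_{i_l}$ for all $k,l\in\mathbb Z$. -}

module Defs where

open import Level using (0ℓ)
open import Data.Product using (Σ; ∃; _×_; _,_; proj₁; proj₂)
open import Data.Integer using (ℤ) renaming (_<_ to _<ℤ_)
open import Relation.Binary.Core using (Rel)
open import Relation.Binary.PropositionalEquality using (_≡_)
open import Relation.Binary.Construct.Closure.Equivalence using (EqClosure)
open import Relation.Nullary using (¬_)
open import Function.Definitions using (Bijective; Surjective; Injective)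

record Str : Set₁ where
  constructor ⟨_,_⟩
  field
    Carrier : Set
    rel     : Rel Carrier 0ℓ
open Str public

IsHom : (A B : Str) → (Carrier A → Carrier B) → Set
IsHom A B f = ∀ {x y} → rel A x y → rel B (f x) (f y)

IsCondensation : (A B : Str) → (Carrier A → Carrier B) → Set
IsCondensation A B f = Bijective _≡_ _≡_ f × IsHom A B f

IsIsomorphism : (A B : Str) → (Carrier A → Carrier B) → Set
IsIsomorphism A B f =
  Bijective _≡_ _≡_ f × (∀ {x y} → rel A x y → rel B (f x) (f y))
                      × (∀ {x y} → rel B (f x) (f y) → rel A x y)

_≅_ : Str → Str → Set
A ≅ B = Σ (Carrier A → Carrier B) (IsIsomorphism A B)

_≼c_ : Str → Str → Set
A ≼c B = Σ (Carrier A → Carrier B) (IsCondensation A B)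

Reversible : Str → Set
Reversible A = ∀ (f : Carrier A → Carrier A) → IsCondensation A A f → IsIsomorphism A A f

-- connected: exactly one component, i.e. nonempty and any two points are
-- related by the equivalence closure of ρ
Connected : Str → Set
Connected A = Σ (Carrier A) (λ _ → ∀ x y → EqClosure (rel A) x y)

data UnionRel {J : Set} (𝕏 : J → Str) : Rel (Σ J (λ j → Carrier (𝕏 j))) 0ℓ where
  inj : ∀ {j x y} → rel (𝕏 j) x y → UnionRel 𝕏 (j , x) (j , y)

-- ⋃_{j ∈ J} 𝕏_j ; domains are made pairwise disjoint by tagging with the index
⋃ : {J : Set} → (J → Str) → Str
⋃ {J} 𝕏 = ⟨ Σ J (λ j → Carrier (𝕏 j)) , UnionRel 𝕏 ⟩

Fiber : {I : Set} → (I → I) → I → Set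
Fiber {I} f j = Σ I (λ i → f i ≡ j)

ReversibleSeq : {I : Set} → (I → Str) → Set
ReversibleSeq {I} 𝕏 =
  ¬ (Σ (I → I) λ f → Surjective _≡_ _≡_ f × ¬ Bijective _≡_ _≡_ f
        × (∀ j → ⋃ (λ (p : Fiber f j) → 𝕏 (proj₁ p)) ≼c 𝕏 j))

IsZSeq : {I : Set} → (I → Str) → (ℤ → I) → Set
IsZSeq 𝕏 s = Injective _≡_ _≡_ s × (∀ k l → k <ℤ l → 𝕏 (s k) ≼c 𝕏 (s l))

TrivialZSeq : {I : Set} → (I → Str) → (ℤ → I) → Set
TrivialZSeq 𝕏 s = ∀ k l → 𝕏 (s k) ≅ 𝕏 (s l)

-- A self-condensation F of ⋃𝕏 with connected pieces maps each piece 𝕏 i into a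
-- single piece 𝕏 (f i), so F = ⋃map f φ for an index map f and piecewise maps φ.
-- F is a bijection iff the induced maps from the fibre unions ⋃_{f i = j} 𝕏 i
-- onto 𝕏 j are, and it reflects the relation iff each φ i does (f injective).
--   ⇒ : A surjection f of I with fibre condensations assembles to a
--       self-condensation of ⋃𝕏; reversibility and connectedness force f to be
--       injective.  Along a ℤ-sequence s, the shift s k ↦ s (k+1) (identity off
--       s) is a self-condensation, so reversibility makes each step an
--       isomorphism.
--   ⇐ : Given F = ⋃map f φ, the reversible sequence condition makes f bijective.
--       Each φ i : 𝕏 i → 𝕏 (f i) then has a condensation back (around a cycle
--       of f, or via the triviality of the ℤ-sequence formed by the f-orbit of
--       i), so φ i reflects by reversibility of 𝕏 i, and hence so does F.  Excluded middle decides membership in a sequence,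
-- bijectivity of f and periodicity of a point.

module Submission where

open import Defs
open import Level using (0ℓ)
open import Axiom.ExcludedMiddle using (ExcludedMiddle)
open import Axiom.UniquenessOfIdentityProofs.WithK using (uip)
open import Data.Empty using (⊥-elim)
open import Data.Integer using (ℤ; +_; -[1+_]; _+_; _-_; -_; ∣_∣; 0ℤ; 1ℤ)
  renaming (suc to sucℤ; pred to predℤ; _≤_ to _≤ℤ_; _<_ to _<ℤ_)
import Data.Integer.Properties as ℤ
open import Data.Nat using (ℕ; zero; suc) renaming (_+_ to _+ℕ_)
import Data.Nat.Properties as ℕ
open import Data.Nat.GeneralisedArithmetic using (iterate)
open import Data.Product using (Σ; _×_; _,_; proj₁; proj₂)
open import Data.Product.Properties using (Σ-≡,≡→≡; Σ-≡,≡←≡; ,-injectiveˡ)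
open import Data.Product.Properties.WithK using (,-injectiveʳ)
open import Data.Sum using (inj₁; inj₂)
open import Function.Base using (id; _∘_)
open import Function.Bundles using (_⇔_; mk⇔; _↔_; mk⤖; Inverse; Bijection)
open import Function.Consequences using (surjective⇒strictlySurjective)
open import Function.Consequences.Propositional using (strictlySurjective⇒surjective)
import Function.Construct.Composition as Composition
import Function.Construct.Identity as Identity
open import Function.Definitions using (Bijective; Surjective; Injective)
open import Function.Properties.Bijection using (⤖⇒↔)
open import Function.Properties.Inverse using (↔⇒⤖; ↔-sym)
open import Relation.Binary.Construct.Closure.Equivalence using (EqClosure; gmap; gfold)
open import Relation.Binary.Definitions using (tri<; tri≈; tri>)
open import Relation.Binary.PropositionalEquality
open import Relation.Nullary using (¬_; Dec; yes; no)
open import Relation.Nullary.Decidable using (decidable-stable)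

module BijectionInverse {A B : Set} {f : A → B} (bij : Bijective _≡_ _≡_ f) where
  private
    f↔ : A ↔ B
    f↔ = ⤖⇒↔ (mk⤖ bij)
  open Inverse f↔ public using (from; strictlyInverseˡ; strictlyInverseʳ)

  from-bijective : Bijective _≡_ _≡_ from
  from-bijective = Bijection.bijective (↔⇒⤖ (↔-sym f↔))

preimage : {A B : Set} {f : A → B} → Surjective _≡_ _≡_ f → ∀ y → Σ A (λ x → f x ≡ y)
preimage = surjective⇒strictlySurjective _≡_ refl

bijective-≗ : {A B : Set} {f g : A → B} → (∀ x → f x ≡ g x)
  → Bijective _≡_ _≡_ f → Bijective _≡_ _≡_ g
bijective-≗ f≗g (f-inj , f-surj) =
  (λ same → f-inj (trans (f≗g _) (trans same (sym (f≗g _))))) ,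
  strictlySurjective⇒surjective (λ y →
    let (x , hit) = preimage f-surj y in x , trans (sym (f≗g x)) hit)

Reflects : (A B : Str) → (Carrier A → Carrier B) → Set
Reflects A B f = ∀ {x y} → rel B (f x) (f y) → rel A x y

cond-id : (A : Str) → IsCondensation A A id
cond-id A = Identity.bijective _≡_ , id

cond-∘ : {A B C : Str} {f : Carrier A → Carrier B} {g : Carrier B → Carrier C}
  → IsCondensation A B f → IsCondensation B C g → IsCondensation A C (g ∘ f)
cond-∘ (f-bij , f-hom) (g-bij , g-hom) =
  Composition.bijective _≡_ _≡_ _≡_ f-bij g-bij , g-hom ∘ f-hom

≼c-refl : {A : Str} → A ≼c A
≼c-refl {A} = id , cond-id A

≼c-trans : {A B C : Str} → A ≼c B → B ≼c C → A ≼c C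
≼c-trans {A} {B} {C} (f , f-cond) (g , g-cond) = g ∘ f , cond-∘ {A} {B} {C} f-cond g-cond

iso : {A B : Str} (f : Carrier A → Carrier B) → IsCondensation A B f → Reflects A B f → A ≅ B
iso f (f-bij , f-hom) f-refl = f , f-bij , f-hom , f-refl

iso⇒≼c : {A B : Str} → A ≅ B → A ≼c B
iso⇒≼c (f , f-bij , f-hom , _) = f , f-bij , f-hom

iso-refl : {A : Str} → A ≅ A
iso-refl {A} = iso {A} {A} id (cond-id A) id

iso-trans : {A B C : Str} → A ≅ B → B ≅ C → A ≅ C
iso-trans {A} {B} {C} (f , f-bij , f-hom , f-refl) (g , g-bij , g-hom , g-refl) =
  iso {A} {C} (g ∘ f) (cond-∘ {A} {B} {C} (f-bij , f-hom) (g-bij , g-hom)) (f-refl ∘ g-refl)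

iso-sym : {A B : Str} → A ≅ B → B ≅ A
iso-sym {A} {B} (f , f-bij , f-hom , f-refl) = from , from-bijective , from-hom , from-refl
  where
  open BijectionInverse f-bij
  from-hom : IsHom B A from
  from-hom {y} {y'} r =
    f-refl {from y} {from y'}
      (subst₂ (rel B) (sym (strictlyInverseˡ y)) (sym (strictlyInverseˡ y')) r)
  from-refl : Reflects B A from
  from-refl {y} {y'} r = subst₂ (rel B) (strictlyInverseˡ y) (strictlyInverseˡ y') (f-hom r)

iso-reflects-closure : {A B : Str} (F : A ≅ B) → ∀ {a b}
  → EqClosure (rel B) (proj₁ F a) (proj₁ F b) → EqClosure (rel A) a b
iso-reflects-closure {A} {B} F@(f , f-bij , _) {a} {b} path =
  subst₂ (EqClosure (rel A)) (strictlyInverseʳ a) (strictlyInverseʳ b)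
    (gmap {R = rel B} from (proj₁ (proj₂ (proj₂ (iso-sym {A} {B} F)))) path)
  where open BijectionInverse f-bij

-- Key use of reversibility: a condensation out of a reversible structure
-- into one that condenses back onto it reflects the relation, since the
-- round trip is a self-condensation and hence an automorphism.
reflects-if-returns : {A B : Str} → Reversible A → (g : Carrier A → Carrier B)
  → IsCondensation A B g → B ≼c A → Reflects A B g
reflects-if-returns {A} {B} rev g g-cond (h , h-cond) r =
  proj₂ (proj₂ (rev (h ∘ g) (cond-∘ {A} {B} {A} g-cond h-cond))) (proj₂ h-cond r)

+-sucℤ : ∀ k n → k + + suc n ≡ sucℤ (k + + n)
+-sucℤ k n = begin
  k + (1ℤ + + n)   ≡⟨ ℤ.+-assoc k 1ℤ (+ n) ⟨
  (k + 1ℤ) + + n   ≡⟨ cong (_+ + n) (ℤ.+-comm k 1ℤ) ⟩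
  (1ℤ + k) + + n   ≡⟨ ℤ.+-assoc 1ℤ k (+ n) ⟩
  1ℤ + (k + + n)   ∎
  where open ≡-Reasoning

≤⇒+ℕ : ∀ {k l} → k ≤ℤ l → Σ ℕ (λ n → l ≡ k + + n)
≤⇒+ℕ {k} {l} k≤l = ∣ l - k ∣ , sym (begin
  k + + ∣ l - k ∣  ≡⟨ cong (_+_ k) (ℤ.0≤i⇒+∣i∣≡i (ℤ.i≤j⇒0≤j-i k≤l)) ⟩
  k + (l - k)      ≡⟨ cong (_+_ k) (ℤ.+-comm l (- k)) ⟩
  k + (- k + l)    ≡⟨ ℤ.+-assoc k (- k) l ⟨
  (k - k) + l      ≡⟨ cong (_+ l) (ℤ.+-inverseʳ k) ⟩
  0ℤ + l           ≡⟨ ℤ.+-identityˡ l ⟩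
  l                ∎)
  where open ≡-Reasoning

sucℤ-injective : ∀ {k l} → sucℤ k ≡ sucℤ l → k ≡ l
sucℤ-injective {k} {l} e = trans (sym (ℤ.pred-suc k)) (trans (cong predℤ e) (ℤ.pred-suc l))

ℤ-chain : (P : ℤ → ℤ → Set)
  → (∀ k → P k k) → (∀ {k l m} → P k l → P l m → P k m)
  → (∀ k → P k (sucℤ k)) → ∀ {k l} → k ≤ℤ l → P k l
ℤ-chain P P-refl P-trans P-step {k} k≤l with ≤⇒+ℕ k≤l
... | n , refl = steps n
  where
  steps : ∀ n → P k (k + + n)
  steps zero    = subst (P k) (sym (ℤ.+-identityʳ k)) (P-refl k)
  steps (suc n) = subst (P k) (sym (+-sucℤ k n)) (P-trans (steps n) (P-step (k + + n)))

module _ {I : Set} (f : I → I) where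

  iterate-+ : ∀ x m n → iterate f x (m +ℕ n) ≡ iterate f (iterate f x m) n
  iterate-+ x zero    n = refl
  iterate-+ x (suc m) n = iterate-+ (f x) m n

  iterate-swap : ∀ x m n → iterate f (iterate f x m) n ≡ iterate f (iterate f x n) m
  iterate-swap x m n = begin
    iterate f (iterate f x m) n  ≡⟨ iterate-+ x m n ⟨
    iterate f x (m +ℕ n)         ≡⟨ cong (iterate f x) (ℕ.+-comm m n) ⟩
    iterate f x (n +ℕ m)         ≡⟨ iterate-+ x n m ⟩
    iterate f (iterate f x n) m  ∎
    where open ≡-Reasoning

  iterate-suc : ∀ x n → iterate f x (suc n) ≡ f (iterate f x n)
  iterate-suc x n = iterate-swap x 1 n

  iterate-injective : Injective _≡_ _≡_ f
    → ∀ n → Injective _≡_ _≡_ (λ x → iterate f x n)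
  iterate-injective f-inj zero    e = e
  iterate-injective f-inj (suc n) e = f-inj (iterate-injective f-inj n e)

  Periodic : I → Set
  Periodic x = Σ ℕ (λ n → iterate f x (suc n) ≡ x)

  periodic-forward : ∀ {x} → Periodic x → ∀ b → Periodic (iterate f x b)
  periodic-forward {x} (n , cycle) b = n , (begin
    iterate f (iterate f x b) (suc n)  ≡⟨ iterate-swap x b (suc n) ⟩
    iterate f (iterate f x (suc n)) b  ≡⟨ cong (λ y → iterate f y b) cycle ⟩
    iterate f x b                      ∎)
    where open ≡-Reasoning

  periodic-backward : Injective _≡_ _≡_ f → ∀ {x} b → Periodic (iterate f x b) → Periodic x
  periodic-backward f-inj {x} b (n , cycle) = n , iterate-injective f-inj b (begin
    iterate f (iterate f x (suc n)) b  ≡⟨ iterate-swap x (suc n) b ⟩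
    iterate f (iterate f x b) (suc n)  ≡⟨ cycle ⟩
    iterate f x b                      ∎)
    where open ≡-Reasoning

  module Walk (g : ℤ → I) (g-step : ∀ k → g (sucℤ k) ≡ f (g k)) where

    walk-iterate : ∀ k n → g (k + + n) ≡ iterate f (g k) n
    walk-iterate k zero    = cong g (ℤ.+-identityʳ k)
    walk-iterate k (suc n) = begin
      g (k + + suc n)          ≡⟨ cong g (+-sucℤ k n) ⟩
      g (sucℤ (k + + n))       ≡⟨ g-step (k + + n) ⟩
      f (g (k + + n))          ≡⟨ cong f (walk-iterate k n) ⟩
      f (iterate f (g k) n)    ≡⟨ iterate-suc (g k) n ⟨
      iterate f (g k) (suc n)  ∎
      where open ≡-Reasoning

    revisit-periodic : ∀ {k l} → k <ℤ l → g k ≡ g l → Periodic (g k)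
    revisit-periodic {k} k<l same with ≤⇒+ℕ (ℤ.i<j⇒suc[i]≤j k<l)
    ... | n , refl = n , (begin
      iterate f (f (g k)) n     ≡⟨ cong (λ y → iterate f y n) (g-step k) ⟨
      iterate f (g (sucℤ k)) n  ≡⟨ walk-iterate (sucℤ k) n ⟨
      g (sucℤ k + + n)          ≡⟨ same ⟨
      g k                       ∎)
      where open ≡-Reasoning

    periodic-at-origin : Injective _≡_ _≡_ f → ∀ k → Periodic (g k) → Periodic (g 0ℤ)
    periodic-at-origin f-inj k cycle with ℤ.≤-total 0ℤ k
    ... | inj₁ 0≤k with ≤⇒+ℕ 0≤k
    ...   | b , refl = periodic-backward f-inj b (subst Periodic (walk-iterate 0ℤ b) cycle)
    periodic-at-origin f-inj k cycle | inj₂ k≤0 with ≤⇒+ℕ k≤0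
    ...   | b , 0≡k+b =
      subst Periodic (trans (sym (walk-iterate k b)) (cong g (sym 0≡k+b))) (periodic-forward cycle b)

    walk-injective : Injective _≡_ _≡_ f → ¬ Periodic (g 0ℤ) → Injective _≡_ _≡_ g
    walk-injective f-inj aperiodic {k} {l} same with ℤ.<-cmp k l
    ... | tri< k<l _ _ = ⊥-elim (aperiodic (periodic-at-origin f-inj k (revisit-periodic k<l same)))
    ... | tri≈ _ k≡l _ = k≡l
    ... | tri> _ _ l<k =
      ⊥-elim (aperiodic (periodic-at-origin f-inj l (revisit-periodic l<k (sym same))))

  module Orbit (f-bij : Bijective _≡_ _≡_ f) (i : I) where
    open BijectionInverse f-bij

    backward : ℕ → I
    backward zero    = from i
    backward (suc n) = from (backward n)

    orbit : ℤ → I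
    orbit (+ n)    = iterate f i n
    orbit -[1+ n ] = backward n

    orbit-step : ∀ k → orbit (sucℤ k) ≡ f (orbit k)
    orbit-step (+ n)        = iterate-suc i n
    orbit-step -[1+ zero ]  = sym (strictlyInverseˡ i)
    orbit-step -[1+ suc n ] = sym (strictlyInverseˡ (backward n))

module Union {I : Set} (𝕏 : I → Str) where

  Piece : I → Set
  Piece i = Carrier (𝕏 i)

  FibreUnion : (I → I) → I → Str
  FibreUnion f j = ⋃ (λ (p : Fiber f j) → 𝕏 (proj₁ p))

  rel-piece : ∀ {i x y} → UnionRel 𝕏 (i , x) (i , y) → rel (𝕏 i) x y
  rel-piece (inj r) = r

  rel-index : ∀ {a b} → UnionRel 𝕏 a b → proj₁ a ≡ proj₁ b
  rel-index (inj _) = refl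

  closure-index : ∀ {a b} → EqClosure (UnionRel 𝕏) a b → proj₁ a ≡ proj₁ b
  closure-index = gfold isEquivalence proj₁ rel-index

  piece-connected : (∀ i → Connected (𝕏 i)) → ∀ {i j} → i ≡ j → ∀ x y
    → EqClosure (UnionRel 𝕏) (i , x) (j , y)
  piece-connected conn {i} refl x y = gmap (i ,_) inj (proj₂ (conn i) x y)

  ⋃map : (f : I → I) → (∀ i → Piece i → Piece (f i))
    → Carrier (⋃ 𝕏) → Carrier (⋃ 𝕏)
  ⋃map f φ (i , x) = f i , φ i x

  module _ (f : I → I) (φ : ∀ i → Piece i → Piece (f i)) where

    hom-from-pieces : (∀ i → IsHom (𝕏 i) (𝕏 (f i)) (φ i))
      → IsHom (⋃ 𝕏) (⋃ 𝕏) (⋃map f φ)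
    hom-from-pieces φ-hom (inj r) = inj (φ-hom _ r)

    hom-to-pieces : IsHom (⋃ 𝕏) (⋃ 𝕏) (⋃map f φ)
      → ∀ i → IsHom (𝕏 i) (𝕏 (f i)) (φ i)
    hom-to-pieces hom i r = rel-piece (hom (inj r))

    reflects-to-pieces : Reflects (⋃ 𝕏) (⋃ 𝕏) (⋃map f φ)
      → ∀ i → Reflects (𝕏 i) (𝕏 (f i)) (φ i)
    reflects-to-pieces refl-⋃ i r = rel-piece (refl-⋃ (inj r))

    -- related images lie in one piece, which for injective f has one preimage piece
    reflects-from-pieces : Injective _≡_ _≡_ f → (∀ i → Reflects (𝕏 i) (𝕏 (f i)) (φ i))
      → Reflects (⋃ 𝕏) (⋃ 𝕏) (⋃map f φ)
    reflects-from-pieces f-inj φ-refl {i , x} {j , y} r with f-inj (rel-index r)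
    ... | refl = inj (φ-refl i (rel-piece r))

    bijective-from-pieces : Bijective _≡_ _≡_ f → (∀ i → Bijective _≡_ _≡_ (φ i))
      → Bijective _≡_ _≡_ (⋃map f φ)
    bijective-from-pieces (f-inj , f-surj) φ-bij =
      injective , strictlySurjective⇒surjective onto
      where
      injective : Injective _≡_ _≡_ (⋃map f φ)
      injective {i , x} {j , y} same with f-inj (,-injectiveˡ same)
      ... | refl = cong (i ,_) (proj₁ (φ-bij i) (,-injectiveʳ same))
      onto : ∀ v → Σ (Carrier (⋃ 𝕏)) (λ u → ⋃map f φ u ≡ v)
      onto (j , y) with preimage f-surj j
      ... | i , refl with preimage (proj₂ (φ-bij i)) y
      ...   | x , refl = (i , x) , refl

    bijective-to-pieces : Injective _≡_ _≡_ f → Bijective _≡_ _≡_ (⋃map f φ)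
      → ∀ i → Bijective _≡_ _≡_ (φ i)
    bijective-to-pieces f-inj (inj-⋃ , surj-⋃) i =
      (λ same → ,-injectiveʳ (inj-⋃ (cong (f i ,_) same))) , strictlySurjective⇒surjective onto
      where
      onto : ∀ y → Σ (Piece i) (λ x → φ i x ≡ y)
      onto y with preimage surj-⋃ (f i , y)
      ... | (j , x) , hit with f-inj (,-injectiveˡ hit)
      ...   | refl = x , ,-injectiveʳ hit

    surjective-index : (∀ j → Piece j) → Surjective _≡_ _≡_ (⋃map f φ)
      → Surjective _≡_ _≡_ f
    surjective-index point surj-⋃ = strictlySurjective⇒surjective λ j →
      let ((i , _) , hit) = preimage surj-⋃ (j , point j) in i , ,-injectiveˡ hit

    gather : ∀ j → Carrier (FibreUnion f j) → Piece j
    gather j ((i , e) , x) = subst Piece e (φ i x)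

    gather-hom : (∀ i → IsHom (𝕏 i) (𝕏 (f i)) (φ i))
      → ∀ j → IsHom (FibreUnion f j) (𝕏 j) (gather j)
    gather-hom φ-hom .(f i) (inj {i , refl} r) = φ-hom i r

    gather-⋃map : ∀ j i (e : f i ≡ j) x → ⋃map f φ (i , x) ≡ (j , gather j ((i , e) , x))
    gather-⋃map .(f i) i refl x = refl

    bijective-from-fibres : (∀ j → Bijective _≡_ _≡_ (gather j))
      → Bijective _≡_ _≡_ (⋃map f φ)
    bijective-from-fibres gather-bij = injective , strictlySurjective⇒surjective onto
      where
      injective : Injective _≡_ _≡_ (⋃map f φ)
      injective {i , x} {i' , x'} same =
        cong (λ { ((i , _) , x) → (i , x) }) (proj₁ (gather-bij (f i')) (,-injectiveʳ
          (trans (sym (gather-⋃map (f i') i (,-injectiveˡ same) x)) same)))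
      onto : ∀ v → Σ (Carrier (⋃ 𝕏)) (λ u → ⋃map f φ u ≡ v)
      onto (j , y) =
        let (((i , e) , x) , hit) = preimage (proj₂ (gather-bij j)) y
        in (i , x) , trans (gather-⋃map j i e x) (cong (j ,_) hit)

    bijective-to-fibres : Bijective _≡_ _≡_ (⋃map f φ)
      → ∀ j → Bijective _≡_ _≡_ (gather j)
    bijective-to-fibres (inj-⋃ , surj-⋃) j = injective , strictlySurjective⇒surjective onto
      where
      same-fibre-point : ∀ {i i' x x'} (e : f i ≡ j) (e' : f i' ≡ j) → (i , x) ≡ (i' , x')
        → _≡_ {A = Carrier (FibreUnion f j)} ((i , e) , x) ((i' , e') , x')
      same-fibre-point e e' refl rewrite uip e e' = refl
      injective : Injective _≡_ _≡_ (gather j)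
      injective {(i , e) , x} {(i' , e') , x'} same = same-fibre-point e e' (inj-⋃ (begin
        ⋃map f φ (i , x)                 ≡⟨ gather-⋃map j i e x ⟩
        (j , gather j ((i , e) , x))     ≡⟨ cong (j ,_) same ⟩
        (j , gather j ((i' , e') , x'))  ≡⟨ gather-⋃map j i' e' x' ⟨
        ⋃map f φ (i' , x')               ∎))
        where open ≡-Reasoning
      onto : ∀ y → Σ (Carrier (FibreUnion f j)) (λ u → gather j u ≡ y)
      onto y with preimage surj-⋃ (j , y)
      ... | (i , x) , hit with Σ-≡,≡←≡ hit
      ...   | e , moved = ((i , e) , x) , moved

  -- With connected pieces, a homomorphism of ⋃𝕏 sends each piece into a
  -- single piece, so it is of the form ⋃map f φ.
  module Decompose (conn : ∀ i → Connected (𝕏 i)) (F : Carrier (⋃ 𝕏) → Carrier (⋃ 𝕏))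
                   (F-hom : IsHom (⋃ 𝕏) (⋃ 𝕏) F) where

    index : I → I
    index i = proj₁ (F (i , proj₁ (conn i)))

    index-of-image : ∀ i x → proj₁ (F (i , x)) ≡ index i
    index-of-image i x =
      closure-index (gmap F F-hom (piece-connected conn refl x (proj₁ (conn i))))

    piece : ∀ i → Piece i → Piece (index i)
    piece i x = subst Piece (index-of-image i x) (proj₂ (F (i , x)))

    F≗⋃map : ∀ u → F u ≡ ⋃map index piece u
    F≗⋃map (i , x) = Σ-≡,≡→≡ (index-of-image i x , refl)

  -- with connected pieces, an automorphism ⋃map f φ is injective on indices:
  -- pieces with the same image lie in one component, hence coincide
  index-injective : (∀ i → Connected (𝕏 i))
    → (f : I → I) (φ : ∀ i → Piece i → Piece (f i))
    → IsIsomorphism (⋃ 𝕏) (⋃ 𝕏) (⋃map f φ) → Injective _≡_ _≡_ f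
  index-injective conn f φ automorphism {i} {i'} same =
    closure-index (iso-reflects-closure {⋃ 𝕏} {⋃ 𝕏} (⋃map f φ , automorphism)
      {i , proj₁ (conn i)} {i' , proj₁ (conn i')} (piece-connected conn same _ _))

  -- Along an injective ℤ-indexed sequence s of indices with condensations
  -- 𝕏 (s k) → 𝕏 (s (k+1)), the shift moves piece s k onto piece s (k+1) and
  -- fixes every piece off the sequence; it is a self-condensation of ⋃𝕏.
  module Shift (lem : ExcludedMiddle 0ℓ) (s : ℤ → I) (s-inj : Injective _≡_ _≡_ s)
               (step : ∀ k → 𝕏 (s k) ≼c 𝕏 (s (sucℤ k))) where

    OnSequence : I → Set
    OnSequence i = Σ ℤ (λ k → s k ≡ i)

    canonical : ∀ k (d : Dec (OnSequence (s k))) → d ≡ yes (k , refl)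
    canonical k (yes (k' , e)) with s-inj e
    ... | refl rewrite uip e refl = refl
    canonical k (no off) = ⊥-elim (off (k , refl))

    next : ∀ i → Dec (OnSequence i) → I
    next i (yes (k , _)) = s (sucℤ k)
    next i (no _)        = i

    advance : ∀ i (d : Dec (OnSequence i)) → Piece i → Piece (next i d)
    advance .(s k) (yes (k , refl)) = proj₁ (step k)
    advance i      (no _)           = id

    advance-cond : ∀ i (d : Dec (OnSequence i))
      → IsCondensation (𝕏 i) (𝕏 (next i d)) (advance i d)
    advance-cond .(s k) (yes (k , refl)) = proj₂ (step k)
    advance-cond i      (no _)           = cond-id (𝕏 i)

    next-injective : ∀ {i i'} (d : Dec (OnSequence i)) (d' : Dec (OnSequence i'))
      → next i d ≡ next i' d' → i ≡ i'
    next-injective (yes (k , refl)) (yes (k' , refl)) same = cong s (sucℤ-injective (s-inj same))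
    next-injective (yes (k , refl)) (no off')         same = ⊥-elim (off' (sucℤ k , same))
    next-injective (no off)         (yes (k' , refl)) same = ⊥-elim (off (sucℤ k' , sym same))
    next-injective (no _)           (no _)            same = same

    shift : I → I
    shift i = next i lem

    shift-bijective : Bijective _≡_ _≡_ shift
    shift-bijective =
      (λ same → next-injective lem lem same) , strictlySurjective⇒surjective onto
      where
      onto : ∀ j → Σ I (λ i → shift i ≡ j)
      onto j with lem {OnSequence j}
      ... | yes (l , refl) = s (predℤ l) ,
              trans (cong (next (s (predℤ l))) (canonical (predℤ l) lem)) (cong s (ℤ.suc-pred l))
      ... | no off = j , shift-off lem
        where
        shift-off : (d : Dec (OnSequence j)) → next j d ≡ j
        shift-off (yes on) = ⊥-elim (off on)
        shift-off (no _)   = refl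

    shift-cond : IsCondensation (⋃ 𝕏) (⋃ 𝕏) (⋃map shift (λ i → advance i lem))
    shift-cond = bijective-from-pieces shift _ shift-bijective (λ i → proj₁ (advance-cond i lem))
               , hom-from-pieces shift _ (λ i → proj₂ (advance-cond i lem))

    step-iso : Reversible (⋃ 𝕏) → ∀ k → 𝕏 (s k) ≅ 𝕏 (s (sucℤ k))
    step-iso rev k = iso {𝕏 (s k)} {𝕏 (s (sucℤ k))} (proj₁ (step k)) (proj₂ (step k))
      (subst (λ d → Reflects (𝕏 (s k)) (𝕏 (next (s k) d)) (advance (s k) d)) (canonical k lem)
        (reflects-to-pieces shift _ (proj₂ (proj₂ (rev _ shift-cond))) (s k)))

  -- If a bijection f of I has 𝕏 i ≼c 𝕏 (f i) for all i and every ℤ-sequence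
  -- is trivial, then each 𝕏 (f i) condenses back onto 𝕏 i: around a cycle of f
  -- by composing the condensations, and otherwise because the f-orbit of i is
  -- a ℤ-sequence, hence consists of isomorphic structures.
  condenses-back : ExcludedMiddle 0ℓ → (∀ s → IsZSeq 𝕏 s → TrivialZSeq 𝕏 s)
    → (f : I → I) → Bijective _≡_ _≡_ f
    → (∀ i → 𝕏 i ≼c 𝕏 (f i)) → ∀ i → 𝕏 (f i) ≼c 𝕏 i
  condenses-back lem trivial f f-bij forward i with lem {Periodic f i}
  ... | yes (n , cycle) = subst (λ j → 𝕏 (f i) ≼c 𝕏 j) cycle (along-iterates (f i) n)
    where
    along-iterates : ∀ j n → 𝕏 j ≼c 𝕏 (iterate f j n)
    along-iterates j zero    = ≼c-refl {𝕏 j}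
    along-iterates j (suc n) =
      ≼c-trans {𝕏 j} {𝕏 (f j)} {𝕏 (iterate f (f j) n)} (forward j) (along-iterates (f j) n)
  ... | no aperiodic = iso⇒≼c {𝕏 (f i)} {𝕏 i}
    (trivial orbit (walk-injective (proj₁ f-bij) aperiodic , ascending) (+ 1) 0ℤ)
    where
    open Orbit f f-bij i
    open Walk f orbit orbit-step
    Ascends : ℤ → ℤ → Set
    Ascends k l = 𝕏 (orbit k) ≼c 𝕏 (orbit l)
    ascending : ∀ k l → k <ℤ l → Ascends k l
    ascending k l k<l = ℤ-chain Ascends (λ k → ≼c-refl {𝕏 (orbit k)})
      (λ {k} {l} {m} → ≼c-trans {𝕏 (orbit k)} {𝕏 (orbit l)} {𝕏 (orbit m)})
      (λ k → subst (λ j → 𝕏 (orbit k) ≼c 𝕏 j) (sym (orbit-step k)) (forward (orbit k)))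
      (ℤ.<⇒≤ k<l)

  -- ⇒, first half: a reversible union makes ⟨𝕏 i⟩ a reversible sequence, since a
  -- surjection f of I with condensations of its fibre unions assembles to a
  -- self-condensation of ⋃𝕏, which is then an automorphism, so f is injective.
  reversible-sequence : (∀ i → Connected (𝕏 i)) → Reversible (⋃ 𝕏) → ReversibleSeq 𝕏
  reversible-sequence conn rev (f , f-surj , f-not-bij , fibre-cond) =
    f-not-bij (index-injective conn f φ (rev (⋃map f φ) (F-bij , F-hom)) , f-surj)
    where
    h : ∀ j → Carrier (FibreUnion f j) → Piece j
    h j = proj₁ (fibre-cond j)
    φ : ∀ i → Piece i → Piece (f i)
    φ i x = h (f i) ((i , refl) , x)
    h≗gather : ∀ j u → h j u ≡ gather f φ j u
    h≗gather .(f i) ((i , refl) , x) = refl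
    F-bij : Bijective _≡_ _≡_ (⋃map f φ)
    F-bij = bijective-from-fibres f φ λ j →
      bijective-≗ (h≗gather j) (proj₁ (proj₂ (fibre-cond j)))
    F-hom : IsHom (⋃ 𝕏) (⋃ 𝕏) (⋃map f φ)
    F-hom = hom-from-pieces f φ λ i r → proj₂ (proj₂ (fibre-cond (f i))) (inj r)

  -- ⇒, second half: a reversible union makes every ℤ-sequence trivial, since
  -- the shift along it turns each step into an isomorphism.
  trivial-sequences : ExcludedMiddle 0ℓ → Reversible (⋃ 𝕏)
    → ∀ s → IsZSeq 𝕏 s → TrivialZSeq 𝕏 s
  trivial-sequences lem rev s (s-inj , ascending) = trivial
    where
    open Shift lem s s-inj (λ k → ascending k (sucℤ k) (ℤ.suc[i]≤j⇒i<j ℤ.≤-refl))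
    Isomorphic : ℤ → ℤ → Set
    Isomorphic k l = 𝕏 (s k) ≅ 𝕏 (s l)
    isomorphic : ∀ {k l} → k ≤ℤ l → Isomorphic k l
    isomorphic = ℤ-chain Isomorphic (λ k → iso-refl {𝕏 (s k)})
      (λ {k} {l} {m} → iso-trans {𝕏 (s k)} {𝕏 (s l)} {𝕏 (s m)}) (step-iso rev)
    trivial : TrivialZSeq 𝕏 s
    trivial k l with ℤ.≤-total k l
    ... | inj₁ k≤l = isomorphic k≤l
    ... | inj₂ l≤k = iso-sym {𝕏 (s l)} {𝕏 (s k)} (isomorphic l≤k)

  -- A self-condensation F of ⋃𝕏 is some
  -- ⋃map f φ; its fibre maps are condensations, so f is a bijection; each φ i is
  -- then a condensation 𝕏 i → 𝕏 (f i) with a condensation back, hence reflects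
  -- the relation, and therefore so does F.
  reversible-union : ExcludedMiddle 0ℓ
    → (∀ i → Connected (𝕏 i)) → (∀ i → Reversible (𝕏 i))
    → ReversibleSeq 𝕏 → (∀ s → IsZSeq 𝕏 s → TrivialZSeq 𝕏 s) → Reversible (⋃ 𝕏)
  reversible-union lem conn rev rseq trivial F (F-bij , F-hom) = F-bij , F-hom , F-refl
    where
    open Decompose conn F F-hom renaming (index to f; piece to φ)
    M-bij : Bijective _≡_ _≡_ (⋃map f φ)
    M-bij = bijective-≗ F≗⋃map F-bij
    M-hom : IsHom (⋃ 𝕏) (⋃ 𝕏) (⋃map f φ)
    M-hom {u} {v} r = subst₂ (UnionRel 𝕏) (F≗⋃map u) (F≗⋃map v) (F-hom r)
    φ-hom : ∀ i → IsHom (𝕏 i) (𝕏 (f i)) (φ i)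
    φ-hom = hom-to-pieces f φ M-hom
    f-bij : Bijective _≡_ _≡_ f
    f-bij = decidable-stable lem λ f-not-bij → rseq
      ( f , surjective-index f φ (λ j → proj₁ (conn j)) (proj₂ M-bij) , f-not-bij
      , λ j → gather f φ j , bijective-to-fibres f φ M-bij j , gather-hom f φ φ-hom j)
    φ-cond : ∀ i → IsCondensation (𝕏 i) (𝕏 (f i)) (φ i)
    φ-cond i = bijective-to-pieces f φ (proj₁ f-bij) M-bij i , φ-hom i
    φ-refl : ∀ i → Reflects (𝕏 i) (𝕏 (f i)) (φ i)
    φ-refl i = reflects-if-returns (rev i) (φ i) (φ-cond i)
      (condenses-back lem trivial f f-bij (λ i → φ i , φ-cond i) i)
    F-refl : Reflects (⋃ 𝕏) (⋃ 𝕏) F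
    F-refl {u} {v} r = reflects-from-pieces f φ (proj₁ f-bij) φ-refl
      (subst₂ (UnionRel 𝕏) (F≗⋃map u) (F≗⋃map v) r)

theorem1p2 : ExcludedMiddle 0ℓ → (I : Set) → (𝕏 : I → Str)
    → (∀ i → Connected (𝕏 i)) → (∀ i → Reversible (𝕏 i))
    → Reversible (⋃ 𝕏)
      ⇔ (ReversibleSeq 𝕏 × (∀ (s : ℤ → I) → IsZSeq 𝕏 s → TrivialZSeq 𝕏 s))
theorem1p2 lem I 𝕏 conn rev = mk⇔
  (λ ⋃-rev → reversible-sequence conn ⋃-rev , trivial-sequences lem ⋃-rev)
  (λ (rseq , trivial) → reversible-union lem conn rev rseq trivial)
  where open Union 𝕏
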